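{- Let $X$ be an $L$-analytic space, $\mathcal{U}=\{U_i:i\in I\}$ a family of admissible open subsets of $X$, and $H^*$ a cohomology theory on admissible opens satisfying the long exact Mayer–Vietoris sequence. Assume that for every finite $J\subset I$ the union $\bigcup_{i\in J}U_i$ has $H^k=0$ for all $k\ge|J|$. Then every finite nonempty intersection $\bigcap_{i\in J}U_i$ is acyclic for $H^*$, i.e. has $H^k=0$ for all $k\ge1$.
   Context: $L$ is a complete extension of a finite extension of $\mathbb{Q}_p$. A typical example of such a cohomology theory is analytic cohomology with coefficients in a fixed sheaf of abelian groups. -}

module Defs where

open import Level using (Level; _⊔_) renaming (suc to lsuc)
open import Data.Nat using (ℕ; zero; suc; _≤_)
open import Data.Product using (_×_; _,_; ∃-syntax)
open import Data.List using (List; []; _∷_; length)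
open import Data.List.Relation.Unary.Unique.Propositional using (Unique)
open import Algebra.Bundles using (AbelianGroup)
open import Algebra.Lattice.Bundles using (DistributiveLattice)
open import Algebra.Morphism.Structures using (module GroupMorphisms)
import Algebra.Construct.DirectProduct as DP
open import Function.Bundles using (_⇔_)

IsHom : ∀ {a ℓa b ℓb} (G : AbelianGroup a ℓa) (H : AbelianGroup b ℓb) →
        (AbelianGroup.Carrier G → AbelianGroup.Carrier H) → Set (a ⊔ ℓa ⊔ ℓb)
IsHom G H f = GroupMorphisms.IsGroupHomomorphism
                (AbelianGroup.rawGroup G) (AbelianGroup.rawGroup H) f

ExactAt : ∀ {a ℓa b ℓb c ℓc} (A : AbelianGroup a ℓa) (B : AbelianGroup b ℓb)
          (C : AbelianGroup c ℓc) →
          (AbelianGroup.Carrier A → AbelianGroup.Carrier B) →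
          (AbelianGroup.Carrier B → AbelianGroup.Carrier C) → Set (a ⊔ b ⊔ ℓb ⊔ ℓc)
ExactAt A B C f g =
  ∀ (y : AbelianGroup.Carrier B) →
    (AbelianGroup._≈_ C (g y) (AbelianGroup.ε C))
      ⇔ (∃[ x ] AbelianGroup._≈_ B (f x) y)

InjHom : ∀ {a ℓa b ℓb} (A : AbelianGroup a ℓa) (B : AbelianGroup b ℓb) →
         (AbelianGroup.Carrier A → AbelianGroup.Carrier B) → Set (a ⊔ ℓa ⊔ ℓb)
InjHom A B f = ∀ x → AbelianGroup._≈_ B (f x) (AbelianGroup.ε B) →
                     AbelianGroup._≈_ A x (AbelianGroup.ε A)

IsZero : ∀ {a ℓa} → AbelianGroup a ℓa → Set (a ⊔ ℓa)
IsZero G = ∀ x → AbelianGroup._≈_ G x (AbelianGroup.ε G)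

-- The lattice of admissible opens of a space: a distributive lattice
-- (meet = intersection, join = union) with a bottom element (the empty open).
record OpenLattice (c ℓ : Level) : Set (lsuc (c ⊔ ℓ)) where
  field
    distLattice : DistributiveLattice c ℓ
  open DistributiveLattice distLattice public
  field
    ∅       : Carrier
    ∅-unit  : ∀ U → (∅ ∨ U) ≈ U

-- A cohomology theory H^* on the admissible opens, satisfying the long exact
-- Mayer–Vietoris sequence
--  0 → H⁰(U∪V) → H⁰(U)⊕H⁰(V) → H⁰(U∩V) → H¹(U∪V) → … → Hᵏ(U∩V) → Hᵏ⁺¹(U∪V) → …
record CohomologyTheory {c ℓ : Level} (X : OpenLattice c ℓ) (a ℓa : Level)
       : Set (lsuc (c ⊔ ℓ ⊔ a ⊔ ℓa)) where
  open OpenLattice X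
  field
    H       : ℕ → Carrier → AbelianGroup a ℓa
    H-resp  : ∀ k {U V} → U ≈ V → IsZero (H k U) → IsZero (H k V)
    mvα     : ∀ k U V → AbelianGroup.Carrier (H k (U ∨ V)) →
              AbelianGroup.Carrier (DP.abelianGroup (H k U) (H k V))
    mvβ     : ∀ k U V → AbelianGroup.Carrier (DP.abelianGroup (H k U) (H k V)) →
              AbelianGroup.Carrier (H k (U ∧ V))
    mvδ     : ∀ k U V → AbelianGroup.Carrier (H k (U ∧ V)) →
              AbelianGroup.Carrier (H (suc k) (U ∨ V))
    mvα-hom : ∀ k U V → IsHom (H k (U ∨ V)) (DP.abelianGroup (H k U) (H k V)) (mvα k U V)
    mvβ-hom : ∀ k U V → IsHom (DP.abelianGroup (H k U) (H k V)) (H k (U ∧ V)) (mvβ k U V)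
    mvδ-hom : ∀ k U V → IsHom (H k (U ∧ V)) (H (suc k) (U ∨ V)) (mvδ k U V)
    exact-start : ∀ U V → InjHom (H 0 (U ∨ V)) (DP.abelianGroup (H 0 U) (H 0 V)) (mvα 0 U V)
    exact-⊕     : ∀ k U V → ExactAt (H k (U ∨ V)) (DP.abelianGroup (H k U) (H k V))
                                    (H k (U ∧ V)) (mvα k U V) (mvβ k U V)
    exact-∩     : ∀ k U V → ExactAt (DP.abelianGroup (H k U) (H k V)) (H k (U ∧ V))
                                    (H (suc k) (U ∨ V)) (mvβ k U V) (mvδ k U V)
    exact-∪     : ∀ k U V → ExactAt (H k (U ∧ V)) (H (suc k) (U ∨ V))
                                    (DP.abelianGroup (H (suc k) U) (H (suc k) V))
                                    (mvδ k U V) (mvα (suc k) U V)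

module _ {c ℓ : Level} (X : OpenLattice c ℓ) where
  open OpenLattice X

  ⋃ : ∀ {ι} {I : Set ι} → (I → Carrier) → List I → Carrier
  ⋃ U []      = ∅
  ⋃ U (j ∷ J) = U j ∨ ⋃ U J

  ⋂⁺ : ∀ {ι} {I : Set ι} → (I → Carrier) → I → List I → Carrier
  ⋂⁺ U j []       = U j
  ⋂⁺ U j (j' ∷ J) = U j ∧ ⋂⁺ U j' J

{-# OPTIONS --safe #-}
-- Induct on the number of opens intersected, proving the stronger claim that
-- for a finite family of indices B disjoint from j ∷ J, with C = ⋃_{b ∈ B} U_b,
-- the intersection ⋂_{i ∈ j ∷ J} (U_i ∪ C) has Hᵏ = 0 for k > |B|; the theorem
-- is the case B = ∅. A single set U_j ∪ C is a union of |B| + 1 members of the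
-- family. For j ∷ j' ∷ J, write the intersection as V ∩ W with V = U_j ∪ C and
-- W = ⋂_{i ∈ j' ∷ J} (U_i ∪ C); by distributivity V ∪ W is the intersection for
-- the larger family j ∷ B, so Hᵏ⁺¹(V ∪ W) = 0, and the Mayer–Vietoris sequence
-- Hᵏ(V) ⊕ Hᵏ(W) → Hᵏ(V ∩ W) → Hᵏ⁺¹(V ∪ W) forces Hᵏ(V ∩ W) = 0.
module Submission where

open import Defs
open import Level using (Level)
open import Data.Nat using (ℕ; _≤_; suc; s≤s)
open import Data.List using (List; _∷_; []; _++_; length)
open import Data.List.Properties using (++-identityʳ)
open import Data.List.Relation.Unary.Unique.Propositional using (Unique)
open import Data.List.Relation.Unary.AllPairs using (_∷_)
open import Data.List.Relation.Binary.Permutation.Propositional using (↭-sym; ↭⇒↭ₛ)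
open import Data.List.Relation.Binary.Permutation.Propositional.Properties using (shift)
open import Data.Product using (_,_)
open import Relation.Binary.PropositionalEquality as ≡ using (_≡_)
open import Function.Bundles using (Equivalence)
open import Algebra.Bundles using (AbelianGroup)
open import Algebra.Morphism.Structures using (module GroupMorphisms)
import Algebra.Construct.DirectProduct as DP
import Algebra.Lattice.Properties.Lattice as LatticeProperties
import Data.List.Relation.Binary.Permutation.Setoid.Properties as PermutationProperties
import Relation.Binary.Reasoning.Setoid as SetoidReasoning

module _ {ι} {I : Set ι} where
  open PermutationProperties (≡.setoid I) using (Unique-resp-↭)

  Unique-++⁻ʳ : ∀ (xs : List I) {ys} → Unique (xs ++ ys) → Unique ys
  Unique-++⁻ʳ []       u       = u
  Unique-++⁻ʳ (x ∷ xs) (_ ∷ u) = Unique-++⁻ʳ xs u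

  Unique-shift : ∀ {x : I} xs {ys} → Unique (x ∷ xs ++ ys) → Unique (xs ++ x ∷ ys)
  Unique-shift {x} xs {ys} = Unique-resp-↭ (↭⇒↭ₛ (↭-sym (shift x xs ys)))

module _ {a ℓa b ℓb : Level} where

  ⊕-isZero : {G : AbelianGroup a ℓa} {H : AbelianGroup b ℓb} →
             IsZero G → IsZero H → IsZero (DP.abelianGroup G H)
  ⊕-isZero zG zH (x , y) = zG x , zH y

module _ {a ℓa b ℓb c ℓc : Level}
         {A : AbelianGroup a ℓa} {B : AbelianGroup b ℓb} {C : AbelianGroup c ℓc} where

  exact-between-zeros-isZero :
    ∀ {f g} → IsHom A B f → ExactAt A B C f g → IsZero A → IsZero C → IsZero B
  exact-between-zeros-isZero f-hom exact zA zC y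
    with Equivalence.to (exact y) (zC _)
  ... | x , fx≈y = B.trans (B.sym fx≈y) (B.trans (⟦⟧-cong (zA x)) ε-homo)
    where
      module B = AbelianGroup B
      open GroupMorphisms.IsGroupHomomorphism f-hom using (⟦⟧-cong; ε-homo)

module _ {c ℓ : Level} (X : OpenLattice c ℓ) where
  open OpenLattice X
  open LatticeProperties lattice using (∨-idem)
  open SetoidReasoning setoid

  ⋂⁺-cong : ∀ {ι} {I : Set ι} {f g : I → Carrier} → (∀ i → f i ≈ g i) →
            ∀ j J → ⋂⁺ X f j J ≈ ⋂⁺ X g j J
  ⋂⁺-cong f≈g j []       = f≈g j
  ⋂⁺-cong f≈g j (j' ∷ J) = ∧-cong (f≈g j) (⋂⁺-cong f≈g j' J)

  ∨-distribˡ-⋂⁺ : ∀ {ι} {I : Set ι} x (f : I → Carrier) j J →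
                  x ∨ ⋂⁺ X f j J ≈ ⋂⁺ X (λ i → x ∨ f i) j J
  ∨-distribˡ-⋂⁺ x f j []       = refl
  ∨-distribˡ-⋂⁺ x f j (j' ∷ J) = begin
    x ∨ (f j ∧ ⋂⁺ X f j' J)                ≈⟨ ∨-distribˡ-∧ x (f j) _ ⟩
    (x ∨ f j) ∧ (x ∨ ⋂⁺ X f j' J)          ≈⟨ ∧-cong refl (∨-distribˡ-⋂⁺ x f j' J) ⟩
    (x ∨ f j) ∧ ⋂⁺ X (λ i → x ∨ f i) j' J  ∎

  ∨-∨-shared : ∀ x y z → (y ∨ z) ∨ (x ∨ z) ≈ x ∨ (y ∨ z)
  ∨-∨-shared x y z = begin
    (y ∨ z) ∨ (x ∨ z)  ≈⟨ ∨-comm _ _ ⟩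
    (x ∨ z) ∨ (y ∨ z)  ≈⟨ ∨-assoc x z _ ⟩
    x ∨ (z ∨ (y ∨ z))  ≈⟨ ∨-cong refl (∨-comm z _) ⟩
    x ∨ ((y ∨ z) ∨ z)  ≈⟨ ∨-cong refl (∨-assoc y z z) ⟩
    x ∨ (y ∨ (z ∨ z))  ≈⟨ ∨-cong refl (∨-cong refl (∨-idem z)) ⟩
    x ∨ (y ∨ z)        ∎

module _ {c ℓ a ℓa : Level} {X : OpenLattice c ℓ} (Hs : CohomologyTheory X a ℓa) where
  open OpenLattice X
  open CohomologyTheory Hs

  mayerVietoris-∧-isZero : ∀ k V W → IsZero (H k V) → IsZero (H k W) →
                           IsZero (H (suc k) (V ∨ W)) → IsZero (H k (V ∧ W))
  mayerVietoris-∧-isZero k V W zV zW zV∨W =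
    exact-between-zeros-isZero
      {A = DP.abelianGroup (H k V) (H k W)} {B = H k (V ∧ W)} {C = H (suc k) (V ∨ W)}
      (mvβ-hom k V W) (exact-∩ k V W) (⊕-isZero {G = H k V} {H = H k W} zV zW) zV∨W

  module _ {ι} {I : Set ι} (U : I → Carrier)
           (⋃-vanishing : ∀ J → Unique J → ∀ k → length J ≤ k → IsZero (H k (⋃ X U J)))
           where

    ⋂⁺-∨⋃-vanishing : ∀ B j J → Unique (j ∷ J ++ B) → ∀ k → suc (length B) ≤ k →
                      IsZero (H k (⋂⁺ X (λ i → U i ∨ ⋃ X U B) j J))
    ⋂⁺-∨⋃-vanishing B j []       u k |B|<k = ⋃-vanishing (j ∷ B) u k |B|<k
    ⋂⁺-∨⋃-vanishing B j (j' ∷ J) u@(_ ∷ u') k |B|<k =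
      mayerVietoris-∧-isZero k V W
        (⋃-vanishing (j ∷ B) (Unique-++⁻ʳ (j' ∷ J) (Unique-shift (j' ∷ J) u)) k |B|<k)
        (⋂⁺-∨⋃-vanishing B j' J u' k |B|<k)
        (H-resp (suc k) ⋂⁺-step≈V∨W
          (⋂⁺-∨⋃-vanishing (j ∷ B) j' J (Unique-shift (j' ∷ J) u) (suc k) (s≤s |B|<k)))
      where
        C V W : Carrier
        C = ⋃ X U B
        V = U j ∨ C
        W = ⋂⁺ X (λ i → U i ∨ C) j' J
        ⋂⁺-step≈V∨W : ⋂⁺ X (λ i → U i ∨ V) j' J ≈ V ∨ W
        ⋂⁺-step≈V∨W = sym (trans (∨-distribˡ-⋂⁺ X V _ j' J)
                                 (⋂⁺-cong X (λ i → ∨-∨-shared X (U i) (U j) C) j' J))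

mainTheorem14 : ∀ {c ℓ a ℓa ι : Level} (X : OpenLattice c ℓ)
                  (Hs : CohomologyTheory X a ℓa)
                  (I : Set ι) (U : I → OpenLattice.Carrier X) →
                  (∀ (J : List I) → Unique J → ∀ (k : ℕ) → length J ≤ k →
                     IsZero (CohomologyTheory.H Hs k (⋃ X U J))) →
                  ∀ (j : I) (J : List I) → Unique (j ∷ J) → ∀ (k : ℕ) → 1 ≤ k →
                     IsZero (CohomologyTheory.H Hs k (⋂⁺ X U j J))
mainTheorem14 X Hs I U ⋃-vanishing j J u k 1≤k =
  H-resp k (⋂⁺-cong X U∨∅≈U j J)
    (⋂⁺-∨⋃-vanishing Hs U ⋃-vanishing [] j J (≡.subst Unique (≡.sym J++[]≡J) u) k 1≤k)
  where
    open OpenLattice X using (_≈_; _∨_; ∅; ∅-unit; ∨-comm; trans)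
    open CohomologyTheory Hs using (H-resp)
    U∨∅≈U : ∀ i → U i ∨ ∅ ≈ U i
    U∨∅≈U i = trans (∨-comm (U i) ∅) (∅-unit (U i))
    J++[]≡J : j ∷ J ++ [] ≡ j ∷ J
    J++[]≡J = ≡.cong (j ∷_) (++-identityʳ J)
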